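{- Let $x\in[0,1]^{E}$ be a feasible solution of the LP $$\sum_{e\in\delta(S)\setminus B}x_e\ge p \ \ \forall S\in\mathcal{C},\ B\subseteq\mathcal{U},\ |B|\le q;\qquad (p+q)\sum_{e\in\delta_{\mathcal{S}}(S)}x_e + p\sum_{e\in\delta_{\mathcal{U}}(S)}x_e\ge p(p+q)\ \ \forall S\in\mathcal{C};\qquad x\in[0,1]^E$$ for an instance of $(p,q)$-Flex-SNDP. Let $F_1\subseteq E$ be a set in which every terminal pair is $(p,q-1)$-flex-connected. Then for every $S\subseteq V$ that is violated with respect to $F_1$, we have $\sum_{e\in\delta(S)\setminus F_1}x_e\ge 1$.
   Context: Setting: undirected graph $G=(V,E)$, $E$ partitioned into safe edges $\mathcal{S}$ and unsafe edges $\mathcal{U}$, terminal pairs $(s_i,t_i)$, $i\in[h]$, all with requirement $(p,q)$, $q\ge1$. A pair is $(p',q')$-flex-connected in $(V,F)$ if it is $p'$-edge-connected in $(V,F\setminus B)$ for every $B\subseteq\mathcal{U}$, $|B|\le q'$. $\mathcal{C}$ is the family of sets $S\subset V$ separating some terminal pair. $\delta_F(S)$ is the set of edges of $F$ with exactly one endpoint in $S$ ($\delta=\delta_E$), $\delta_{\mathcal{S}}(S)=\delta(S)\cap\mathcal{S}$, $\delta_{\mathcal{U}}(S)=\delta(S)\cap\mathcal{U}$. A set $S$ is violated with respect to $F_1$ if $S$ separates a terminal pair, $|\delta_{F_1\cap\mathcal{S}}(S)|<p$, and $|\delta_{F_1}(S)|=p+q-1$.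
   Formalization: The feasible LP solution x has rational entries in [0,1] instead of real ones. -}

module Defs where

open import Data.Bool using (Bool; true; false; not; _xor_; T)
open import Data.Nat as ℕ using (ℕ; zero; suc)
open import Data.Integer using (+_)
open import Data.Fin using (Fin)
open import Data.Fin.Subset using (Subset; ∁; _∩_; _─_; _⊆_; ∣_∣)
open import Data.Vec using (Vec; []; _∷_; lookup; tabulate)
open import Data.Rational using (ℚ; 0ℚ; _/_) renaming (_+_ to _+ℚ_)
open import Data.Product using (∃)

-- An (undirected, possibly multi-) graph on vertex set Fin n with edge set Fin m,
-- together with the partition of the edges into safe and unsafe edges.
record Graph (n m : ℕ) : Set where
  field
    tail   : Fin m → Fin n
    head   : Fin m → Fin n
    isSafe : Fin m → Bool
open Graph public

module _ {n m : ℕ} (G : Graph n m) where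

  safeEdges : Subset m
  safeEdges = tabulate (isSafe G)

  unsafeEdges : Subset m
  unsafeEdges = ∁ safeEdges

  δ : Subset n → Subset m
  δ S = tabulate (λ e → lookup S (tail G e) xor lookup S (head G e))

  δ[_] : Subset m → Subset n → Subset m
  δ[ F ] S = δ S ∩ F

Separates : {n : ℕ} → Subset n → Fin n → Fin n → Set
Separates S u v = T (lookup S u xor lookup S v)

InC : {n h : ℕ} → (s t : Fin h → Fin n) → Subset n → Set
InC s t S = ∃ λ i → Separates S (s i) (t i)

EdgeConnected : {n m : ℕ} → Graph n m → ℕ → Subset m → Fin n → Fin n → Set
EdgeConnected G p' F u v = (S : Subset _) → Separates S u v → p' ℕ.≤ ∣ δ[_] G F S ∣

FlexConnected : {n m : ℕ} → Graph n m → ℕ → ℕ → Subset m → Fin n → Fin n → Set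
FlexConnected G p' q' F u v =
  (B : Subset _) → B ⊆ unsafeEdges G → ∣ B ∣ ℕ.≤ q' → EdgeConnected G p' (F ─ B) u v

ℕ→ℚ : ℕ → ℚ
ℕ→ℚ k = + k / 1

sumOver : {m : ℕ} → Subset m → (Fin m → ℚ) → ℚ
sumOver [] x = 0ℚ
sumOver (true  ∷ F) x = x Fin.zero +ℚ sumOver F (λ e → x (Fin.suc e))
sumOver (false ∷ F) x = sumOver F (λ e → x (Fin.suc e))

-- Fewer than p of the p + q − 1 edges of δ_{F₁}(S) are safe, so at least q of them are unsafe;
-- let B be q of them. The first family of LP constraints gives x(δ(S) ∖ B) ≥ p, while x ≤ 1 on the
-- p − 1 edges of δ_{F₁}(S) ∖ B gives x(δ(S) ∖ B) ≤ x(δ(S) ∖ F₁) + p − 1.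
{-# OPTIONS --safe #-}
module Submission where

open import Defs
open import Data.Nat using (ℕ; _≤_; _<_; _+_; _∸_; _*_)
open import Data.Fin using (Fin)
open import Data.Fin.Subset using (Subset; _─_; _∩_; _⊆_; ∣_∣)
open import Data.Rational using (ℚ; 0ℚ; 1ℚ) renaming (_≤_ to _≤ℚ_; _+_ to _+ℚ_; _*_ to _*ℚ_)
open import Data.Product using (_×_)
open import Relation.Binary.PropositionalEquality using (_≡_)

open import Data.Bool using (true; false)
open import Data.Fin using (zero; suc)
open import Data.Fin.Subset using (⊥; ∁)
open import Data.Fin.Subset.Properties
  using (⊆-min; ∣⊥∣≡0; in⊆in; out⊆; drop-∷-⊆; ⊆-trans; p─q⊆p; ∩-assoc)
open import Data.Integer as ℤ using (+_)
import Data.Integer.Properties as ℤ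
import Data.Nat as ℕ
import Data.Nat.Properties as ℕ
open import Data.Nat.Coprimality using (1-coprimeTo) renaming (sym to coprime-sym)
open import Data.Rational as ℚ using (mkℚ)
import Data.Rational.Properties as ℚ
open import Data.Product using (∃-syntax; _,_; proj₂)
open import Relation.Nullary using (contradiction)
open import Function using (_∘_)
open import Algebra.Bundles using (CommutativeMonoid)
open import Algebra.Properties.CommutativeSemigroup
  (CommutativeMonoid.commutativeSemigroup ℚ.+-0-commutativeMonoid) using (x∙yz≈y∙xz)
open import Data.Vec using (_∷_; []; here; there)
open import Relation.Binary.PropositionalEquality
  using (refl; sym; trans; cong; cong₂; subst; subst₂; module ≡-Reasoning)

subsetOfSize : ∀ {m k} (P : Subset m) → k ≤ ∣ P ∣ → ∃[ B ] B ⊆ P × ∣ B ∣ ≡ k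
subsetOfSize {m} {ℕ.zero}  P           _             = ⊥ , ⊆-min P , ∣⊥∣≡0 m
subsetOfSize {k = ℕ.suc k} (true ∷ P)  (ℕ.s≤s k≤∣P∣) with subsetOfSize P k≤∣P∣
... | B , B⊆P , ∣B∣≡k = true ∷ B , in⊆in B⊆P , cong ℕ.suc ∣B∣≡k
subsetOfSize {k = ℕ.suc k} (false ∷ P) k<∣P∣         with subsetOfSize P k<∣P∣
... | B , B⊆P , ∣B∣≡k = false ∷ B , out⊆ B⊆P , ∣B∣≡k

p─q⊆∁q : ∀ {m} (P Q : Subset m) → P ─ Q ⊆ ∁ Q
p─q⊆∁q (true ∷ P)  (false ∷ Q) here          = here
p─q⊆∁q (false ∷ P) (false ∷ Q) {zero} ()
p─q⊆∁q (_ ∷ P)     (true ∷ Q)  {zero} ()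
p─q⊆∁q (_ ∷ P)     (_ ∷ Q)     (there x∈P─Q) = there (p─q⊆∁q P Q x∈P─Q)

∣p∣≡∣p∩q∣+∣p─q∣ : ∀ {m} (P Q : Subset m) → ∣ P ∣ ≡ ∣ P ∩ Q ∣ + ∣ P ─ Q ∣
∣p∣≡∣p∩q∣+∣p─q∣ []          []          = refl
∣p∣≡∣p∩q∣+∣p─q∣ (true ∷ P)  (true ∷ Q)  = cong ℕ.suc (∣p∣≡∣p∩q∣+∣p─q∣ P Q)
∣p∣≡∣p∩q∣+∣p─q∣ (true ∷ P)  (false ∷ Q) =
  trans (cong ℕ.suc (∣p∣≡∣p∩q∣+∣p─q∣ P Q)) (sym (ℕ.+-suc _ _))
∣p∣≡∣p∩q∣+∣p─q∣ (false ∷ P) (true ∷ Q)  = ∣p∣≡∣p∩q∣+∣p─q∣ P Q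
∣p∣≡∣p∩q∣+∣p─q∣ (false ∷ P) (false ∷ Q) = ∣p∣≡∣p∩q∣+∣p─q∣ P Q

ℕ→ℚ≡mkℚ : ∀ a → ℕ→ℚ a ≡ mkℚ (+ a) 0 (coprime-sym (1-coprimeTo a))
ℕ→ℚ≡mkℚ a = ℚ.↥p/↧p≡p (mkℚ (+ a) 0 (coprime-sym (1-coprimeTo a)))

ℕ→ℚ-+ : ∀ a b → ℕ→ℚ (a + b) ≡ ℕ→ℚ a +ℚ ℕ→ℚ b
ℕ→ℚ-+ a b = begin
  ℕ→ℚ (a + b)                          ≡⟨ cong (ℚ._/ 1) (cong₂ ℤ._+_ (ℤ.*-identityʳ (+ a)) (ℤ.*-identityʳ (+ b))) ⟨
  (+ a ℤ.* + 1 ℤ.+ + b ℤ.* + 1) ℚ./ 1  ≡⟨ cong₂ _+ℚ_ (ℕ→ℚ≡mkℚ a) (ℕ→ℚ≡mkℚ b) ⟨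
  ℕ→ℚ a +ℚ ℕ→ℚ b                       ∎
  where open ≡-Reasoning

+ℕ→ℚ-suc : ∀ a n → a +ℚ ℕ→ℚ (ℕ.suc n) ≡ 1ℚ +ℚ (a +ℚ ℕ→ℚ n)
+ℕ→ℚ-suc a n = trans (cong (a +ℚ_) (ℕ→ℚ-+ 1 n)) (x∙yz≈y∙xz a 1ℚ (ℕ→ℚ n))

sumOver[p─r]+∣r∣≤sumOver[p─q]+∣p∩q∣ : ∀ {m} (x : Fin m → ℚ) → (∀ e → x e ≤ℚ 1ℚ) →
  (P Q R : Subset m) → R ⊆ P ∩ Q →
  sumOver (P ─ R) x +ℚ ℕ→ℚ ∣ R ∣ ≤ℚ sumOver (P ─ Q) x +ℚ ℕ→ℚ ∣ P ∩ Q ∣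
sumOver[p─r]+∣r∣≤sumOver[p─q]+∣p∩q∣ x x≤1 [] [] [] _ = ℚ.≤-refl
sumOver[p─r]+∣r∣≤sumOver[p─q]+∣p∩q∣ x x≤1 (p ∷ P) (q ∷ Q) (r ∷ R) R⊆P∩Q = step p q r R⊆P∩Q
  where
  x[P─R] x[P─Q] : ℚ
  x[P─R] = sumOver (P ─ R) (x ∘ suc)
  x[P─Q] = sumOver (P ─ Q) (x ∘ suc)

  ih : x[P─R] +ℚ ℕ→ℚ ∣ R ∣ ≤ℚ x[P─Q] +ℚ ℕ→ℚ ∣ P ∩ Q ∣
  ih = sumOver[p─r]+∣r∣≤sumOver[p─q]+∣p∩q∣ (x ∘ suc) (x≤1 ∘ suc) P Q R (drop-∷-⊆ R⊆P∩Q)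

  step : ∀ p q r → r ∷ R ⊆ (p ∷ P) ∩ (q ∷ Q) →
    sumOver ((p ∷ P) ─ (r ∷ R)) x +ℚ ℕ→ℚ ∣ r ∷ R ∣ ≤ℚ
    sumOver ((p ∷ P) ─ (q ∷ Q)) x +ℚ ℕ→ℚ ∣ (p ∷ P) ∩ (q ∷ Q) ∣
  step true  true  true  _ =
    subst₂ _≤ℚ_ (sym (+ℕ→ℚ-suc x[P─R] ∣ R ∣)) (sym (+ℕ→ℚ-suc x[P─Q] ∣ P ∩ Q ∣)) (ℚ.+-monoʳ-≤ 1ℚ ih)
  step true  true  false _ =
    subst₂ _≤ℚ_ (sym (ℚ.+-assoc (x zero) x[P─R] _)) (sym (+ℕ→ℚ-suc x[P─Q] ∣ P ∩ Q ∣))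
      (ℚ.+-mono-≤ (x≤1 zero) ih)
  step true  false false _ =
    subst₂ _≤ℚ_ (sym (ℚ.+-assoc (x zero) x[P─R] _)) (sym (ℚ.+-assoc (x zero) x[P─Q] _))
      (ℚ.+-monoʳ-≤ (x zero) ih)
  step false true  false _ = ih
  step false false false _ = ih
  step true  false true  r∷R⊆ = contradiction (r∷R⊆ here) λ ()
  step false _     true  r∷R⊆ = contradiction (r∷R⊆ here) λ ()

p+[1+k]∸1≡p+k : ∀ p k → p + ℕ.suc k ∸ 1 ≡ p + k
p+[1+k]∸1≡p+k p k = cong (ℕ._∸ 1) (ℕ.+-suc p k)

a<p∧a+c≡p+q∸1⇒q≤c : ∀ {a c p q} → 1 ≤ q → a < p → a + c ≡ p + q ∸ 1 → q ≤ c
a<p∧a+c≡p+q∸1⇒q≤c {a} {c} {p} {ℕ.suc k} _ a<p a+c≡p+q∸1 = ℕ.+-cancelˡ-≤ a (ℕ.suc k) c (begin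
  a + ℕ.suc k  ≡⟨ ℕ.+-suc a k ⟩
  ℕ.suc a + k  ≤⟨ ℕ.+-monoˡ-≤ k a<p ⟩
  p + k        ≡⟨ trans a+c≡p+q∸1 (p+[1+k]∸1≡p+k p k) ⟨
  a + c        ∎)
  where open ℕ.≤-Reasoning

+-cancelʳ-≤ : ∀ a b c → a +ℚ c ≤ℚ b +ℚ c → a ≤ℚ b
+-cancelʳ-≤ a b c a+c≤b+c = subst₂ _≤ℚ_ (z+c-c≡z a) (z+c-c≡z b) (ℚ.+-monoˡ-≤ (ℚ.- c) a+c≤b+c)
  where
  z+c-c≡z : ∀ z → (z +ℚ c) +ℚ ℚ.- c ≡ z
  z+c-c≡z z = trans (ℚ.+-assoc z c (ℚ.- c)) (trans (cong (z +ℚ_) (ℚ.+-inverseʳ c)) (ℚ.+-identityʳ z))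

p≤a∧a+q≤y+[p+q∸1]⇒1≤y : ∀ p q {a y} → 1 ≤ q →
  ℕ→ℚ p ≤ℚ a → a +ℚ ℕ→ℚ q ≤ℚ y +ℚ ℕ→ℚ (p + q ∸ 1) → 1ℚ ≤ℚ y
p≤a∧a+q≤y+[p+q∸1]⇒1≤y p (ℕ.suc k) {a} {y} _ p≤a a+q≤y+[p+q∸1] = +-cancelʳ-≤ 1ℚ y (ℕ→ℚ (p + k)) (begin
  1ℚ +ℚ ℕ→ℚ (p + k)           ≡⟨ ℕ→ℚ-+ 1 (p + k) ⟨
  ℕ→ℚ (ℕ.suc (p + k))         ≡⟨ cong ℕ→ℚ (ℕ.+-suc p k) ⟨
  ℕ→ℚ (p + ℕ.suc k)           ≡⟨ ℕ→ℚ-+ p (ℕ.suc k) ⟩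
  ℕ→ℚ p +ℚ ℕ→ℚ (ℕ.suc k)      ≤⟨ ℚ.+-monoˡ-≤ (ℕ→ℚ (ℕ.suc k)) p≤a ⟩
  a +ℚ ℕ→ℚ (ℕ.suc k)          ≤⟨ subst (λ n → a +ℚ ℕ→ℚ (ℕ.suc k) ≤ℚ y +ℚ ℕ→ℚ n) (p+[1+k]∸1≡p+k p k) a+q≤y+[p+q∸1] ⟩
  y +ℚ ℕ→ℚ (p + k)            ∎)
  where open ℚ.≤-Reasoning

lemma2p4 : {n m h : ℕ} (G : Graph n m) (s t : Fin h → Fin n) (p q : ℕ) → 1 ≤ q →
  (x : Fin m → ℚ) →
  ((e : Fin m) → (0ℚ ≤ℚ x e) × (x e ≤ℚ 1ℚ)) →
  ((S : Subset n) → InC s t S → (B : Subset m) → B ⊆ unsafeEdges G → ∣ B ∣ ≤ q →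
    ℕ→ℚ p ≤ℚ sumOver (δ G S ─ B) x) →
  ((S : Subset n) → InC s t S →
    ℕ→ℚ (p * (p + q)) ≤ℚ
      (ℕ→ℚ (p + q) *ℚ sumOver (δ[_] G (safeEdges G) S) x
        +ℚ ℕ→ℚ p *ℚ sumOver (δ[_] G (unsafeEdges G) S) x)) →
  (F₁ : Subset m) →
  ((i : Fin h) → FlexConnected G p (q ∸ 1) F₁ (s i) (t i)) →
  (S : Subset n) → InC s t S →
  ∣ δ[_] G (F₁ ∩ safeEdges G) S ∣ < p →
  ∣ δ[_] G F₁ S ∣ ≡ p + q ∸ 1 →
  1ℚ ≤ℚ sumOver (δ G S ─ F₁) x
lemma2p4 {m = m} G s t p q 1≤q x 0≤x≤1 cutLP _ F₁ _ S S∈𝒞 ∣δ𝒮F₁∣<p ∣δF₁∣≡p+q∸1 =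
  let B , B⊆A , ∣B∣≡q = subsetOfSize A q≤∣A∣ in
  p≤a∧a+q≤y+[p+q∸1]⇒1≤y p q 1≤q
    (cutLP S S∈𝒞 B (⊆-trans B⊆A (p─q⊆∁q P 𝒮)) (ℕ.≤-reflexive ∣B∣≡q))
    (subst₂ (λ b c → sumOver (D ─ B) x +ℚ ℕ→ℚ b ≤ℚ sumOver (D ─ F₁) x +ℚ ℕ→ℚ c) ∣B∣≡q ∣δF₁∣≡p+q∸1
      (sumOver[p─r]+∣r∣≤sumOver[p─q]+∣p∩q∣ x (proj₂ ∘ 0≤x≤1) D F₁ B (⊆-trans B⊆A (p─q⊆p P 𝒮))))
  where
  𝒮 D P A : Subset m
  𝒮 = safeEdges G
  D = δ G S
  P = D ∩ F₁
  A = P ─ 𝒮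

  q≤∣A∣ : q ≤ ∣ A ∣
  q≤∣A∣ = a<p∧a+c≡p+q∸1⇒q≤c 1≤q ∣δ𝒮F₁∣<p (begin
    ∣ D ∩ (F₁ ∩ 𝒮) ∣ + ∣ A ∣  ≡⟨ cong (λ Q → ∣ Q ∣ + ∣ A ∣) (∩-assoc D F₁ 𝒮) ⟨
    ∣ P ∩ 𝒮 ∣ + ∣ A ∣         ≡⟨ ∣p∣≡∣p∩q∣+∣p─q∣ P 𝒮 ⟨
    ∣ P ∣                     ≡⟨ ∣δF₁∣≡p+q∸1 ⟩
    p + q ∸ 1                 ∎)
    where open ≡-Reasoning
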